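{- For every ab-ba rotor type $r$, $m(UU(r))+m(DD(r))=2m(r)$.
   Context: A two-state rotor type is an infinite periodic sequence $r=(r^{(1)},r^{(2)},\dots)$ over $\{1,2\}$ with fundamental period $|r|$ (convention $r^{(1)}=1$). It is ab-ba if $|r|$ is even and for every $k\ge0$ the pair $(r^{(2k+1)},r^{(2k+2)})$ is $(1,2)$ or $(2,1)$. For such a sequence $s$ of even period, if exactly $k$ of the pairs $(s^{(2i+1)},s^{(2i+2)})$, $0\le i<|s|/2$, equal $(2,1)$, the ba-frequency is $m(s)=2k/|s|$ (labels are taken literally, not renormalized). Rotor-router dynamics: at each non-target vertex $v$ there is a periodic sequence $e_v^{(1)},e_v^{(2)},\dots$ of out-edges; a particle starts at the source, on its $j$-th visit to $v$ leaves along $e_v^{(j)}$, and whenever it reaches a target it is returned to the source; the hitting sequence is the (periodic) sequence of targets reached. The compressor for $r$ has non-target vertices $1$ (source), $2,3$ and targets $4,5$. On the $j$-th departure: from vertex $1$ the particle goes to vertex $2$ if $r^{(j)}=1$ and to vertex $3$ if $r^{(j)}=2$; from vertex $2$, in variant $U$ it goes to vertex $1$ if $r^{(j)}=1$ and to target $4$ if $r^{(j)}=2$, in variant $D$ to target $4$ if $r^{(j)}=1$ and to vertex $1$ if $r^{(j)}=2$; from vertex $3$ likewise with target $5$. $UU(r)$ (resp. $DD(r)$) is the hitting sequence with variant $U$ (resp. $D$) at both vertices $2$ and $3$, written with $4$ replaced by $1$ and $5$ by $2$; it is again ab-ba. -}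

module Defs where

open import Data.Nat using (ℕ; zero; suc; _+_; _*_; _<_; _/_)
open import Data.Nat.Properties using (_≟_)
open import Data.Integer using (+_)
import Data.Rational as ℚ
open import Data.Rational using (ℚ)
open import Data.Product using (Σ; _×_; _,_; ∃)
open import Data.Sum using (_⊎_)
open import Data.Maybe using (Maybe; just; nothing)
open import Relation.Binary.PropositionalEquality using (_≡_)
open import Relation.Nullary using (¬_)

data Two : Set where
  ₁ ₂ : Two

-- Sequences are indexed from 0: s i is the paper's s^(i+1).
Seq : Set
Seq = ℕ → Two

IsPeriod : Seq → ℕ → Set
IsPeriod s p = ∀ i → s (i + p) ≡ s i

IsFundPeriod : Seq → ℕ → Set
IsFundPeriod s p = (0 < p) × IsPeriod s p × (∀ q → 0 < q → q < p → ¬ IsPeriod s q)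

Even : ℕ → Set
Even n = ∃ λ k → n ≡ 2 * k

IsAbBa : Seq → ℕ → Set
IsAbBa r p = Even p × (∀ k → (r (2 * k) ≡ ₁ × r (1 + 2 * k) ≡ ₂) ⊎ (r (2 * k) ≡ ₂ × r (1 + 2 * k) ≡ ₁))

isBA : Two → Two → ℕ
isBA ₂ ₁ = 1
isBA _ _ = 0

baCount : Seq → ℕ → ℕ
baCount s zero = 0
baCount s (suc n) = baCount s n + isBA (s (2 * n)) (s (1 + 2 * n))

-- ba-frequency m(s) = 2k/|s| computed from the period q = |s|
baFreq : Seq → ℕ → ℚ
baFreq s zero = ℚ.0ℚ
baFreq s (suc n) = (+ (2 * baCount s (suc n / 2))) ℚ./ suc n

data Variant : Set where
  U D : Variant

data Vtx : Set where
  v1 v2 v3 v4 v5 : Vtx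

-- position and the number of departures already made from vertices 1,2,3
record State : Set where
  constructor st
  field
    pos : Vtx
    c1 c2 c3 : ℕ

initState : State
initState = st v1 0 0 0

exitV : Variant → Vtx → Two → Vtx
exitV U tgt ₁ = v1
exitV U tgt ₂ = tgt
exitV D tgt ₁ = tgt
exitV D tgt ₂ = v1

step : Seq → Variant → State → State
step r var (st v1 a b c) with r a
... | ₁ = st v2 (suc a) b c
... | ₂ = st v3 (suc a) b c
step r var (st v2 a b c) = st (exitV var v4 (r b)) a (suc b) c
step r var (st v3 a b c) = st (exitV var v5 (r c)) a b (suc c)
-- reaching a target: the particle is returned to the source
step r var (st v4 a b c) = st v1 a b c
step r var (st v5 a b c) = st v1 a b c

traj : Seq → Variant → ℕ → State
traj r var zero = initState
traj r var (suc t) = step r var (traj r var t)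

targetLabel : State → Maybe Two
targetLabel (st v4 _ _ _) = just ₁
targetLabel (st v5 _ _ _) = just ₂
targetLabel _ = nothing

isTarget : State → ℕ
isTarget s with targetLabel s
... | just _ = 1
... | nothing = 0

hitsBefore : Seq → Variant → ℕ → ℕ
hitsBefore r var zero = 0
hitsBefore r var (suc t) = hitsBefore r var t + isTarget (traj r var t)

-- h is the hitting sequence: the (n+1)-th target reached has label h n
IsHitSeq : Seq → Variant → Seq → Set
IsHitSeq r var h = ∀ n → ∃ λ t → targetLabel (traj r var t) ≡ just (h n) × hitsBefore r var t ≡ n

-- The compressor works in blocks of ten steps. A block starts at the source with the rotor counters
-- at (4k, 2k, 2k): the source then reads x₀, x̄₀, x₂, x̄₂ (x₀ = r(4k), x₂ = r(4k+2), x̄ the other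
-- label), vertices 2 and 3 each read y, ȳ (y = r(2k)), exactly two targets are reached, with labels
-- f, f̄, and the block ends at the source with counters (4k+4, 2k+2, 2k+2). In variant U the first
-- label f is x₀ if y = 2 and x₂ if y = 1; in variant D it is the other way round. So UU(r) and DD(r)
-- are ab-ba, inherit the even periods of r, and their k-th pairs together contribute exactly the
-- ba-pairs 2k and 2k+1 of r; over a common period this gives m(UU(r)) + m(DD(r)) = 2 m(r).
module Submission where

open import Defs

module _ where
  open import Data.Nat using (ℕ; zero; suc; _+_; _*_; _<_; _/_; _<ᵇ_; z≤n; s≤s)
  open import Data.Nat.Properties
    using ( +-identityʳ; +-assoc; +-comm; +-suc; *-suc; *-comm; *-assoc; *-distribˡ-+
          ; _<?_; ≮⇒≥; m≤n⇒∃[o]m+o≡n; m<n+m; anyUpTo?; allUpTo?; +-commutativeSemigroup)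
  open import Algebra.Properties.CommutativeSemigroup +-commutativeSemigroup using (interchange)
  open import Data.Nat.DivMod using (m*n/n≡m)
  open import Data.Nat.GeneralisedArithmetic using (fold)
  open import Data.Nat.Induction using (<-rec)
  open import Data.Nat.Tactic.RingSolver using (solve-∀)
  open import Data.Integer as ℤ using (+_)
  open import Data.Integer.Properties using (pos-+; pos-*)
  import Data.Rational as ℚ
  open import Data.Rational.Properties
    using (fromℚᵘ-cong; toℚᵘ-injective; toℚᵘ-fromℚᵘ; toℚᵘ-homo-+; toℚᵘ-homo-*)
  import Data.Rational.Unnormalised as ℚᵘ
  open import Data.Rational.Unnormalised using (mkℚᵘ; *≡*)
  open import Data.Rational.Unnormalised.Properties using (+-cong; *-congˡ; module ≃-Reasoning)
  open import Data.Bool using (Bool; true; T; _∧_)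
  open import Data.Bool.Properties using (T-∧)
  open import Data.Unit using (tt)
  open import Data.Maybe using (just)
  open import Data.Product using (∃; _×_; _,_; proj₁; proj₂)
  open import Data.Sum using (_⊎_; inj₁; inj₂)
  open import Data.Empty using (⊥-elim)
  open import Function using (_∘_; Equivalence)
  open import Relation.Nullary using (Dec; yes; no)
  open import Relation.Nullary.Decidable using (map′; _×-dec_)
  open import Relation.Binary.Definitions using (DecidableEquality)
  open import Relation.Binary.PropositionalEquality
    using (_≡_; _≢_; refl; sym; trans; cong; cong₂; module ≡-Reasoning)

  other : Two → Two
  other ₁ = ₂
  other ₂ = ₁

  other-involutive : ∀ x → other (other x) ≡ x
  other-involutive ₁ = refl
  other-involutive ₂ = refl

  other-≢ : ∀ x → other x ≢ x
  other-≢ ₁ ()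
  other-≢ ₂ ()

  _≟₂_ : DecidableEquality Two
  ₁ ≟₂ ₁ = yes refl
  ₁ ≟₂ ₂ = no λ ()
  ₂ ≟₂ ₁ = no λ ()
  ₂ ≟₂ ₂ = yes refl

  even⊎odd : ∀ n → ∃ λ k → n ≡ 2 * k ⊎ n ≡ 1 + 2 * k
  even⊎odd zero = 0 , inj₁ refl
  even⊎odd (suc n) with even⊎odd n
  ... | k , inj₁ refl = k , inj₂ refl
  ... | k , inj₂ refl = suc k , inj₁ (sym (*-suc 2 k))

  -- Periodic and pair-flipped sequences

  isPeriod-* : ∀ {s P} → IsPeriod s P → ∀ c → IsPeriod s (c * P)
  isPeriod-* {s} per zero i = cong s (+-identityʳ i)
  isPeriod-* {s} {P} per (suc c) i = begin
    s (i + (P + c * P)) ≡⟨ cong s (trans (cong (λ n → i + n) (+-comm P (c * P))) (sym (+-assoc i (c * P) P))) ⟩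
    s (i + c * P + P)   ≡⟨ per (i + c * P) ⟩
    s (i + c * P)       ≡⟨ isPeriod-* per c i ⟩
    s i                 ∎
    where open ≡-Reasoning

  module KnownPeriod {s : Seq} {P : ℕ} (0<P : 0 < P) (perP : IsPeriod s P) where
    open ≡-Reasoning

    isPeriod-fromPrefix : ∀ {q} → (∀ {i} → i < P → s (i + q) ≡ s i) → IsPeriod s q
    isPeriod-fromPrefix {q} prefix = <-rec _ shiftBack
      where
      shiftBack : ∀ i → (∀ {j} → j < i → s (j + q) ≡ s j) → s (i + q) ≡ s i
      shiftBack i rec with i <? P
      ... | yes i<P = prefix i<P
      ... | no i≮P with m≤n⇒∃[o]m+o≡n (≮⇒≥ i≮P)
      ... | j , refl = begin
        s (P + j + q) ≡⟨ cong s (trans (+-assoc P j q) (+-comm P (j + q))) ⟩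
        s (j + q + P) ≡⟨ perP (j + q) ⟩
        s (j + q)     ≡⟨ rec (m<n+m j 0<P) ⟩
        s j           ≡⟨ sym (perP j) ⟩
        s (j + P)     ≡⟨ cong s (+-comm j P) ⟩
        s (P + j)     ∎

    isPeriod? : ∀ q → Dec (IsPeriod s q)
    isPeriod? q = map′ isPeriod-fromPrefix (λ per {i} _ → per i)
                       (allUpTo? (λ i → s (i + q) ≟₂ s i) P)

    fundamentalPeriod : ∃ (IsFundPeriod s)
    fundamentalPeriod = <-rec (λ Q → 0 < Q → IsPeriod s Q → ∃ (IsFundPeriod s)) descend P 0<P perP
      where
      descend : ∀ Q → (∀ {Q′} → Q′ < Q → 0 < Q′ → IsPeriod s Q′ → ∃ (IsFundPeriod s))
              → 0 < Q → IsPeriod s Q → ∃ (IsFundPeriod s)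
      descend Q rec 0<Q perQ with anyUpTo? (λ q → (0 <? q) ×-dec isPeriod? q) Q
      ... | yes (q , q<Q , 0<q , perq) = rec q<Q 0<q perq
      ... | no none = Q , 0<Q , perQ , λ q 0<q q<Q perq → none (q , q<Q , 0<q , perq)

  -- The ab-ba condition, without the evenness of the period.
  PairFlipped : Seq → Set
  PairFlipped s = ∀ j → s (1 + 2 * j) ≡ other (s (2 * j))

  abBa⇒pairFlipped : ∀ {r p} → IsAbBa r p → PairFlipped r
  abBa⇒pairFlipped (_ , abba) j with abba j
  ... | inj₁ (first , second) = trans second (cong other (sym first))
  ... | inj₂ (first , second) = trans second (cong other (sym first))

  pairFlipped-at : ∀ {s} → PairFlipped s → ∀ {n} j → n ≡ 2 * j → s (1 + n) ≡ other (s n)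
  pairFlipped-at flipped j refl = flipped j

  module _ {s : Seq} (flipped : PairFlipped s) where
    open ≡-Reasoning

    oddPeriod⇒alternating : ∀ {k} → IsPeriod s (1 + 2 * k) → ∀ i → s (suc i) ≡ other (s i)
    oddPeriod⇒alternating {k} per i with even⊎odd i
    ... | j , inj₁ refl = flipped j
    ... | j , inj₂ refl = begin
      s (2 + 2 * j)                       ≡⟨ per (2 + 2 * j) ⟨
      s (2 + 2 * j + (1 + 2 * k))         ≡⟨ cong s (odd-shift j k) ⟩
      s (1 + 2 * (1 + j + k))             ≡⟨ flipped (1 + j + k) ⟩
      other (s (2 * (1 + j + k)))         ≡⟨ cong (other ∘ s) (even-shift j k) ⟨
      other (s (1 + 2 * j + (1 + 2 * k))) ≡⟨ cong other (per (1 + 2 * j)) ⟩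
      other (s (1 + 2 * j))               ∎
      where
      odd-shift : ∀ j k → 2 + 2 * j + (1 + 2 * k) ≡ 1 + 2 * (1 + j + k)
      odd-shift = solve-∀
      even-shift : ∀ j k → 1 + 2 * j + (1 + 2 * k) ≡ 2 * (1 + j + k)
      even-shift = solve-∀

    fundamentalPeriod-even : ∀ {q} → IsFundPeriod s q → Even q
    fundamentalPeriod-even {q} (_ , per , minimal) with even⊎odd q
    ... | k , inj₁ q≡2k = k , q≡2k
    ... | zero , inj₂ refl = ⊥-elim (other-≢ (s 0) (trans (sym (flipped 0)) (per 0)))
    ... | suc k , inj₂ refl = ⊥-elim (minimal 2 (s≤s z≤n) 2<q period2)
      where
      2<q : 2 < 1 + 2 * suc k
      2<q rewrite *-suc 2 k = s≤s (s≤s (s≤s z≤n))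
      period2 : IsPeriod s 2
      period2 i = begin
        s (i + 2)              ≡⟨ cong s (+-suc i 1) ⟩
        s (suc (i + 1))        ≡⟨ cong (s ∘ suc) (+-suc i 0) ⟩
        s (suc (suc (i + 0)))  ≡⟨ cong (s ∘ suc ∘ suc) (+-identityʳ i) ⟩
        s (suc (suc i))        ≡⟨ oddPeriod⇒alternating {suc k} per (suc i) ⟩
        other (s (suc i))      ≡⟨ cong other (oddPeriod⇒alternating {suc k} per i) ⟩
        other (other (s i))    ≡⟨ other-involutive (s i) ⟩
        s i                    ∎

  pairsWith : (ℕ → Two) → Seq
  pairsWith f zero = f 0
  pairsWith f (suc zero) = other (f 0)
  pairsWith f (suc (suc n)) = pairsWith (f ∘ suc) n

  pairsWith-even : ∀ f k → pairsWith f (2 * k) ≡ f k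
  pairsWith-even f zero = refl
  pairsWith-even f (suc k) = trans (cong (pairsWith f) (*-suc 2 k)) (pairsWith-even (f ∘ suc) k)

  pairsWith-odd : ∀ f k → pairsWith f (1 + 2 * k) ≡ other (f k)
  pairsWith-odd f zero = refl
  pairsWith-odd f (suc k) = trans (cong (pairsWith f ∘ suc) (*-suc 2 k)) (pairsWith-odd (f ∘ suc) k)

  pairsWith-pairFlipped : ∀ f → PairFlipped (pairsWith f)
  pairsWith-pairFlipped f j = trans (pairsWith-odd f j) (cong other (sym (pairsWith-even f j)))

  pairsWith-period : ∀ {f M} → IsPeriod f M → IsPeriod (pairsWith f) (2 * M)
  pairsWith-period {f} {M} per i with even⊎odd i
  ... | k , inj₁ refl = begin
    pairsWith f (2 * k + 2 * M) ≡⟨ cong (pairsWith f) (*-distribˡ-+ 2 k M) ⟨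
    pairsWith f (2 * (k + M))   ≡⟨ pairsWith-even f (k + M) ⟩
    f (k + M)                   ≡⟨ per k ⟩
    f k                         ≡⟨ pairsWith-even f k ⟨
    pairsWith f (2 * k)         ∎
    where open ≡-Reasoning
  ... | k , inj₂ refl = begin
    pairsWith f (1 + 2 * k + 2 * M) ≡⟨ cong (pairsWith f ∘ suc) (*-distribˡ-+ 2 k M) ⟨
    pairsWith f (1 + 2 * (k + M))   ≡⟨ pairsWith-odd f (k + M) ⟩
    other (f (k + M))               ≡⟨ cong other (per k) ⟩
    other (f k)                     ≡⟨ pairsWith-odd f k ⟨
    pairsWith f (1 + 2 * k)         ∎
    where open ≡-Reasoning

  -- ba-counts and ba-frequencies

  module _ {s : Seq} {a : ℕ} (per : IsPeriod s (2 * a)) where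
    open ≡-Reasoning

    baCount-+ : ∀ n → baCount s (a + n) ≡ baCount s a + baCount s n
    baCount-+ zero = trans (cong (baCount s) (+-identityʳ a)) (sym (+-identityʳ _))
    baCount-+ (suc n) = begin
      baCount s (a + suc n)
        ≡⟨ cong (baCount s) (+-suc a n) ⟩
      baCount s (a + n) + isBA (s (2 * (a + n))) (s (1 + 2 * (a + n)))
        ≡⟨ cong₂ _+_ (baCount-+ n) (cong₂ isBA (shift (2 * n) (even-index n a)) (shift (1 + 2 * n) (odd-index n a))) ⟩
      baCount s a + baCount s n + isBA (s (2 * n)) (s (1 + 2 * n))
        ≡⟨ +-assoc (baCount s a) _ _ ⟩
      baCount s a + baCount s (suc n) ∎
      where
      shift : ∀ i {j} → j ≡ i + 2 * a → s j ≡ s i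
      shift i refl = per i
      even-index : ∀ n a → 2 * (a + n) ≡ 2 * n + 2 * a
      even-index = solve-∀
      odd-index : ∀ n a → 1 + 2 * (a + n) ≡ 1 + 2 * n + 2 * a
      odd-index = solve-∀

    baCount-* : ∀ c → baCount s (c * a) ≡ c * baCount s a
    baCount-* zero = refl
    baCount-* (suc c) = trans (baCount-+ (c * a)) (cong (λ m → baCount s a + m) (baCount-* c))

  baCount-cross : ∀ {s a b} → IsPeriod s (2 * a) → IsPeriod s (2 * b) → baCount s a * b ≡ baCount s b * a
  baCount-cross {s} {a} {b} perA perB = begin
    baCount s a * b   ≡⟨ *-comm (baCount s a) b ⟩
    b * baCount s a   ≡⟨ baCount-* perA b ⟨
    baCount s (b * a) ≡⟨ cong (baCount s) (*-comm b a) ⟩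
    baCount s (a * b) ≡⟨ baCount-* perB a ⟩
    a * baCount s b   ≡⟨ *-comm a (baCount s b) ⟩
    baCount s b * a   ∎
    where open ≡-Reasoning

  baWeight : Two → ℕ
  baWeight x = isBA x (other x)

  baCount-pairFlipped-suc : ∀ {s} → PairFlipped s → ∀ n → baCount s (suc n) ≡ baCount s n + baWeight (s (2 * n))
  baCount-pairFlipped-suc {s} flipped n = cong (λ x → baCount s n + isBA (s (2 * n)) x) (flipped n)

  baCount-pairsWith-suc : ∀ f n → baCount (pairsWith f) (suc n) ≡ baCount (pairsWith f) n + baWeight (f n)
  baCount-pairsWith-suc f n =
    cong₂ (λ x y → baCount (pairsWith f) n + isBA x y) (pairsWith-even f n) (pairsWith-odd f n)

  /-cross : ∀ X Y d e → X * suc e ≡ Y * suc d → + X ℚ./ suc d ≡ + Y ℚ./ suc e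
  /-cross X Y d e eq =
    fromℚᵘ-cong {mkℚᵘ (+ X) d} {mkℚᵘ (+ Y) e} (*≡* (trans (sym (pos-* X (suc e))) (trans (cong +_ eq) (pos-* Y (suc d)))))

  cleared-denominators : ∀ X Y Z m → X + Y ≡ 2 * Z →
    (+ X ℤ.* + m ℤ.+ + Y ℤ.* + m) ℤ.* + (1 * m) ≡ (+ 2 ℤ.* + Z) ℤ.* + (m * m)
  cleared-denominators X Y Z m eq = begin
    (+ X ℤ.* + m ℤ.+ + Y ℤ.* + m) ℤ.* + (1 * m)
      ≡⟨ cong (ℤ._* + (1 * m)) (trans (pos-+ (X * m) (Y * m)) (cong₂ ℤ._+_ (pos-* X m) (pos-* Y m))) ⟨
    + (X * m + Y * m) ℤ.* + (1 * m)  ≡⟨ pos-* (X * m + Y * m) (1 * m) ⟨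
    + ((X * m + Y * m) * (1 * m))    ≡⟨ cong +_ (rearrange X Y m) ⟩
    + ((X + Y) * (m * m))            ≡⟨ cong (λ w → + (w * (m * m))) eq ⟩
    + (2 * Z * (m * m))              ≡⟨ trans (pos-* (2 * Z) (m * m)) (cong (ℤ._* + (m * m)) (pos-* 2 Z)) ⟩
    (+ 2 ℤ.* + Z) ℤ.* + (m * m)      ∎
    where
    open ≡-Reasoning
    rearrange : ∀ X Y m → (X * m + Y * m) * (1 * m) ≡ (X + Y) * (m * m)
    rearrange = solve-∀

  /-sum : ∀ X Y Z d → X + Y ≡ 2 * Z →
          + X ℚ./ suc d ℚ.+ + Y ℚ./ suc d ≡ (+ 2 ℚ./ 1) ℚ.* (+ Z ℚ./ suc d)
  /-sum X Y Z d eq = toℚᵘ-injective (begin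
    ℚ.toℚᵘ (x ℚ.+ y)                  ≈⟨ toℚᵘ-homo-+ x y ⟩
    ℚ.toℚᵘ x ℚᵘ.+ ℚ.toℚᵘ y            ≈⟨ +-cong (toℚᵘ-fromℚᵘ (mkℚᵘ (+ X) d)) (toℚᵘ-fromℚᵘ (mkℚᵘ (+ Y) d)) ⟩
    mkℚᵘ (+ X) d ℚᵘ.+ mkℚᵘ (+ Y) d    ≈⟨ *≡* (cleared-denominators X Y Z (suc d) eq) ⟩
    mkℚᵘ (+ 2) 0 ℚᵘ.* mkℚᵘ (+ Z) d    ≈⟨ *-congˡ {mkℚᵘ (+ 2) 0} (toℚᵘ-fromℚᵘ (mkℚᵘ (+ Z) d)) ⟨
    ℚ.toℚᵘ two ℚᵘ.* ℚ.toℚᵘ z          ≈⟨ toℚᵘ-homo-* two z ⟨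
    ℚ.toℚᵘ (two ℚ.* z)                ∎)
    where
    open ≃-Reasoning
    x y z two : ℚ.ℚ
    x = + X ℚ./ suc d
    y = + Y ℚ./ suc d
    z = + Z ℚ./ suc d
    two = + 2 ℚ./ 1

  half-double : ∀ n → 2 * n / 2 ≡ n
  half-double n = trans (cong (_/ 2) (*-comm 2 n)) (m*n/n≡m n 2)

  baFreq-double : ∀ s n → baFreq s (2 * suc n) ≡ + baCount s (suc n) ℚ./ suc n
  baFreq-double s n =
    trans (cong (λ m → + (2 * baCount s m) ℚ./ (2 * suc n)) (half-double (suc n)))
          (/-cross (2 * c) c _ n (trans (cong (_* suc n) (*-comm 2 c)) (*-assoc c 2 (suc n))))
    where
    c : ℕ
    c = baCount s (suc n)

  baFreq-periodInvariant : ∀ {s p q} → 0 < p → 0 < q → Even p → Even q →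
                           IsPeriod s p → IsPeriod s q → baFreq s p ≡ baFreq s q
  baFreq-periodInvariant () _ (zero , refl) _ _ _
  baFreq-periodInvariant _ () (suc a , refl) (zero , refl) _ _
  baFreq-periodInvariant {s} _ _ (suc a , refl) (suc b , refl) perA perB = begin
    baFreq s (2 * suc a)            ≡⟨ baFreq-double s a ⟩
    + baCount s (suc a) ℚ./ suc a   ≡⟨ /-cross (baCount s (suc a)) (baCount s (suc b)) a b
                                                (baCount-cross {s} {suc a} {suc b} perA perB) ⟩
    + baCount s (suc b) ℚ./ suc b   ≡⟨ baFreq-double s b ⟨
    baFreq s (2 * suc b)            ∎
    where open ≡-Reasoning

  baFreq-sum : ∀ {s t u} n → baCount s (suc n) + baCount t (suc n) ≡ 2 * baCount u (suc n) →
               baFreq s (2 * suc n) ℚ.+ baFreq t (2 * suc n) ≡ (+ 2 ℚ./ 1) ℚ.* baFreq u (2 * suc n)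
  baFreq-sum {s} {t} {u} n counts = begin
    baFreq s (2 * suc n) ℚ.+ baFreq t (2 * suc n)
      ≡⟨ cong₂ ℚ._+_ (baFreq-double s n) (baFreq-double t n) ⟩
    + baCount s (suc n) ℚ./ suc n ℚ.+ + baCount t (suc n) ℚ./ suc n
      ≡⟨ /-sum (baCount s (suc n)) (baCount t (suc n)) (baCount u (suc n)) n counts ⟩
    (+ 2 ℚ./ 1) ℚ.* (+ baCount u (suc n) ℚ./ suc n)
      ≡⟨ cong ((+ 2 ℚ./ 1) ℚ.*_) (baFreq-double u n) ⟨
    (+ 2 ℚ./ 1) ℚ.* baFreq u (2 * suc n) ∎
    where open ≡-Reasoning

  fundamentalPeriod-pairFlipped : ∀ {s P} → PairFlipped s → 0 < P → Even P → IsPeriod s P →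
    ∃ λ q → IsFundPeriod s q × Even q × baFreq s q ≡ baFreq s P
  fundamentalPeriod-pairFlipped flipped 0<P evenP perP with KnownPeriod.fundamentalPeriod 0<P perP
  ... | q , fund@(0<q , perq , _) =
    q , fund , evenq , baFreq-periodInvariant 0<q 0<P evenq evenP perq perP
    where
    evenq : Even q
    evenq = fundamentalPeriod-even flipped fund

  -- One block of the compressor

  pick : Two → Vtx
  pick ₁ = v2
  pick ₂ = v3

  step-source : ∀ r var a b c → step r var (st v1 a b c) ≡ st (pick (r a)) (suc a) b c
  step-source r var a b c with r a
  ... | ₁ = refl
  ... | ₂ = refl

  firstLabel : Variant → Two → Two → Two → Two
  firstLabel U x₀ x₂ ₁ = x₂
  firstLabel U x₀ x₂ ₂ = x₀
  firstLabel D x₀ x₂ ₁ = x₀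
  firstLabel D x₀ x₂ ₂ = x₂

  firstLabel-U+D : ∀ (w : Two → ℕ) x₀ x₂ y →
                   w (firstLabel U x₀ x₂ y) + w (firstLabel D x₀ x₂ y) ≡ w x₀ + w x₂
  firstLabel-U+D w x₀ x₂ ₁ = +-comm (w x₂) (w x₀)
  firstLabel-U+D w x₀ x₂ ₂ = refl

  -- The first target is reached after 2 steps if the first move out of vertex 2 or 3 leaves the
  -- compressor (y = 2 for U, y = 1 for D), and after 6 steps otherwise.
  firstHitTime : Variant → Two → ℕ
  firstHitTime U ₁ = 6
  firstHitTime U ₂ = 2
  firstHitTime D ₁ = 2
  firstHitTime D ₂ = 6

  -- Positions past the window are never read (readsInWindow), so the values given there are arbitrary.
  sourceWindow : Two → Two → Seq
  sourceWindow x₀ x₂ 0 = x₀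
  sourceWindow x₀ x₂ 1 = other x₀
  sourceWindow x₀ x₂ 2 = x₂
  sourceWindow x₀ x₂ (suc (suc (suc _))) = other x₂

  relayWindow : Two → Seq
  relayWindow y zero = y
  relayWindow y (suc _) = other y

  blockStep : Variant → Two → Two → Two → State → State
  blockStep var x₀ x₂ y (st v1 a b c) = st (pick (sourceWindow x₀ x₂ a)) (suc a) b c
  blockStep var x₀ x₂ y (st v2 a b c) = st (exitV var v4 (relayWindow y b)) a (suc b) c
  blockStep var x₀ x₂ y (st v3 a b c) = st (exitV var v5 (relayWindow y c)) a b (suc c)
  blockStep var x₀ x₂ y (st v4 a b c) = st v1 a b c
  blockStep var x₀ x₂ y (st v5 a b c) = st v1 a b c

  readsInWindow : State → Bool
  readsInWindow (st v1 a b c) = a <ᵇ 4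
  readsInWindow (st v2 a b c) = b <ᵇ 2
  readsInWindow (st v3 a b c) = c <ᵇ 2
  readsInWindow (st v4 a b c) = true
  readsInWindow (st v5 a b c) = true

  staysInWindow : (State → State) → State → ℕ → Bool
  staysInWindow f x zero = true
  staysInWindow f x (suc n) = staysInWindow f x n ∧ readsInWindow (fold x f n)

  hitsIn : (State → State) → State → ℕ → ℕ
  hitsIn f x zero = 0
  hitsIn f x (suc n) = hitsIn f x n + isTarget (fold x f n)

  record BlockRun (var : Variant) (x₀ x₂ y : Two) : Set where
    constructor computed
    F : State → State
    F = blockStep var x₀ x₂ y
    j₀ : ℕ
    j₀ = firstHitTime var y
    j₁ : ℕ
    j₁ = 3 + j₀
    field
      ends         : fold initState F 10 ≡ st v1 4 2 2
      hitsAtEnd    : hitsIn F initState 10 ≡ 2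
      windowAtEnd  : T (staysInWindow F initState 10)
      firstTarget  : targetLabel (fold initState F j₀) ≡ just (firstLabel var x₀ x₂ y)
      hitsAtFirst  : hitsIn F initState j₀ ≡ 0
      windowFirst  : T (staysInWindow F initState j₀)
      secondTarget : targetLabel (fold initState F j₁) ≡ just (other (firstLabel var x₀ x₂ y))
      hitsAtSecond : hitsIn F initState j₁ ≡ 1
      windowSecond : T (staysInWindow F initState j₁)

  blockRun : ∀ var x₀ x₂ y → BlockRun var x₀ x₂ y
  blockRun U ₁ ₁ ₁ = computed refl refl tt refl refl tt refl refl tt
  blockRun U ₁ ₁ ₂ = computed refl refl tt refl refl tt refl refl tt
  blockRun U ₁ ₂ ₁ = computed refl refl tt refl refl tt refl refl tt
  blockRun U ₁ ₂ ₂ = computed refl refl tt refl refl tt refl refl tt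
  blockRun U ₂ ₁ ₁ = computed refl refl tt refl refl tt refl refl tt
  blockRun U ₂ ₁ ₂ = computed refl refl tt refl refl tt refl refl tt
  blockRun U ₂ ₂ ₁ = computed refl refl tt refl refl tt refl refl tt
  blockRun U ₂ ₂ ₂ = computed refl refl tt refl refl tt refl refl tt
  blockRun D ₁ ₁ ₁ = computed refl refl tt refl refl tt refl refl tt
  blockRun D ₁ ₁ ₂ = computed refl refl tt refl refl tt refl refl tt
  blockRun D ₁ ₂ ₁ = computed refl refl tt refl refl tt refl refl tt
  blockRun D ₁ ₂ ₂ = computed refl refl tt refl refl tt refl refl tt
  blockRun D ₂ ₁ ₁ = computed refl refl tt refl refl tt refl refl tt
  blockRun D ₂ ₁ ₂ = computed refl refl tt refl refl tt refl refl tt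
  blockRun D ₂ ₂ ₁ = computed refl refl tt refl refl tt refl refl tt
  blockRun D ₂ ₂ ₂ = computed refl refl tt refl refl tt refl refl tt

  traj-+ : ∀ r var j t → traj r var (j + t) ≡ fold (traj r var t) (step r var) j
  traj-+ r var zero t = refl
  traj-+ r var (suc j) t = cong (step r var) (traj-+ r var j t)

  hitsBefore-+ : ∀ r var j t →
                 hitsBefore r var (j + t) ≡ hitsBefore r var t + hitsIn (step r var) (traj r var t) j
  hitsBefore-+ r var zero t = sym (+-identityʳ _)
  hitsBefore-+ r var (suc j) t = begin
    hitsBefore r var (j + t) + isTarget (traj r var (j + t))
      ≡⟨ cong₂ _+_ (hitsBefore-+ r var j t) (cong isTarget (traj-+ r var j t)) ⟩
    hitsBefore r var t + hitsIn (step r var) (traj r var t) j + isTarget (fold (traj r var t) (step r var) j)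
      ≡⟨ +-assoc (hitsBefore r var t) _ _ ⟩
    hitsBefore r var t + hitsIn (step r var) (traj r var t) (suc j) ∎
    where open ≡-Reasoning

  -- While the block run only reads inside the windows, the real run from the counters (A, B, B) is
  -- the block run with every counter shifted.
  module Shifted (r : Seq) (var : Variant) (A B : ℕ)
                 (flip₀ : r (1 + A) ≡ other (r A)) (flip₂ : r (3 + A) ≡ other (r (2 + A)))
                 (flipᵧ : r (1 + B) ≡ other (r B)) where

    shift : State → State
    shift (st p a b c) = st p (a + A) (b + B) (c + B)

    F : State → State
    F = blockStep var (r A) (r (2 + A)) (r B)

    source-reads : ∀ a → T (a <ᵇ 4) → r (a + A) ≡ sourceWindow (r A) (r (2 + A)) a
    source-reads 0 _ = refl
    source-reads 1 _ = flip₀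
    source-reads 2 _ = refl
    source-reads 3 _ = flip₂

    relay-reads : ∀ b → T (b <ᵇ 2) → r (b + B) ≡ relayWindow (r B) b
    relay-reads 0 _ = refl
    relay-reads 1 _ = flipᵧ

    step-shift : ∀ s → T (readsInWindow s) → step r var (shift s) ≡ shift (F s)
    step-shift (st v1 a b c) ok = trans (step-source r var (a + A) (b + B) (c + B))
      (cong (λ x → st (pick x) (suc a + A) (b + B) (c + B)) (source-reads a ok))
    step-shift (st v2 a b c) ok = cong (λ x → st (exitV var v4 x) (a + A) (suc b + B) (c + B)) (relay-reads b ok)
    step-shift (st v3 a b c) ok = cong (λ x → st (exitV var v5 x) (a + A) (b + B) (suc c + B)) (relay-reads c ok)
    step-shift (st v4 a b c) ok = refl
    step-shift (st v5 a b c) ok = refl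

    shift-preservesTarget : ∀ s → targetLabel (shift s) ≡ targetLabel s × isTarget (shift s) ≡ isTarget s
    shift-preservesTarget (st v1 a b c) = refl , refl
    shift-preservesTarget (st v2 a b c) = refl , refl
    shift-preservesTarget (st v3 a b c) = refl , refl
    shift-preservesTarget (st v4 a b c) = refl , refl
    shift-preservesTarget (st v5 a b c) = refl , refl

    run-shift : ∀ j → T (staysInWindow F initState j) → fold (shift initState) (step r var) j ≡ shift (fold initState F j)
    run-shift zero _ = refl
    run-shift (suc j) ok with Equivalence.to T-∧ ok
    ... | earlier , now = trans (cong (step r var) (run-shift j earlier)) (step-shift (fold initState F j) now)

    hits-shift : ∀ j → T (staysInWindow F initState j) → hitsIn (step r var) (shift initState) j ≡ hitsIn F initState j
    hits-shift zero _ = refl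
    hits-shift (suc j) ok with Equivalence.to T-∧ ok
    ... | earlier , _ = cong₂ _+_ (hits-shift j earlier)
      (trans (cong isTarget (run-shift j earlier)) (proj₂ (shift-preservesTarget (fold initState F j))))

  -- The hitting sequences

  fourfold : ∀ k → k * 4 ≡ 2 * (2 * k)
  fourfold = solve-∀

  fourfold+2 : ∀ k → 2 + k * 4 ≡ 2 * (1 + 2 * k)
  fourfold+2 = solve-∀

  blockHead : Variant → Seq → ℕ → Two
  blockHead var r k = firstLabel var (r (k * 4)) (r (2 + k * 4)) (r (k * 2))

  hitSeq : Variant → Seq → Seq
  hitSeq var r = pairsWith (blockHead var r)

  module Blocks {r : Seq} (flipped : PairFlipped r) (var : Variant) where

    module Block (k : ℕ) where
      open Shifted r var (k * 4) (k * 2) (pairFlipped-at {r} flipped (2 * k) (fourfold k))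
        (pairFlipped-at {r} flipped (1 + 2 * k) (fourfold+2 k)) (pairFlipped-at {r} flipped k (*-comm k 2)) public
      open BlockRun (blockRun var (r (k * 4)) (r (2 + k * 4)) (r (k * 2))) public hiding (F)

      module FromStart (atStart : traj r var (k * 10) ≡ st v1 (k * 4) (k * 2) (k * 2)) where

        traj-inBlock : ∀ j → T (staysInWindow F initState j) → traj r var (j + k * 10) ≡ shift (fold initState F j)
        traj-inBlock j ok =
          trans (traj-+ r var j (k * 10)) (trans (cong (λ x → fold x (step r var) j) atStart) (run-shift j ok))

        hitsBefore-inBlock : ∀ j → T (staysInWindow F initState j) →
                             hitsBefore r var (j + k * 10) ≡ hitsBefore r var (k * 10) + hitsIn F initState j
        hitsBefore-inBlock j ok = trans (hitsBefore-+ r var j (k * 10))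
          (cong (λ h → hitsBefore r var (k * 10) + h) (trans (cong (λ x → hitsIn (step r var) x j) atStart) (hits-shift j ok)))

        hit-inBlock : ∀ j {label m n} → T (staysInWindow F initState j) →
          targetLabel (fold initState F j) ≡ just label → hitsIn F initState j ≡ m → hitsBefore r var (k * 10) + m ≡ n →
          ∃ λ t → targetLabel (traj r var t) ≡ just label × hitsBefore r var t ≡ n
        hit-inBlock j ok label hits count = j + k * 10 ,
          trans (cong targetLabel (traj-inBlock j ok)) (trans (proj₁ (shift-preservesTarget (fold initState F j))) label) ,
          trans (hitsBefore-inBlock j ok) (trans (cong (λ h → hitsBefore r var (k * 10) + h) hits) count)

    blockStart : ∀ k → traj r var (k * 10) ≡ st v1 (k * 4) (k * 2) (k * 2)
    blockStart zero = refl
    blockStart (suc k) = trans (traj-inBlock 10 windowAtEnd) (cong shift ends)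
      where open Block k
            open FromStart (blockStart k)

    hitsAtBlockStart : ∀ k → hitsBefore r var (k * 10) ≡ k * 2
    hitsAtBlockStart zero = refl
    hitsAtBlockStart (suc k) = trans (hitsBefore-inBlock 10 windowAtEnd)
        (trans (cong₂ _+_ (hitsAtBlockStart k) hitsAtEnd) (+-comm (k * 2) 2))
      where open Block k
            open FromStart (blockStart k)

    hitSeq-isHitSeq : IsHitSeq r var (hitSeq var r)
    hitSeq-isHitSeq n with even⊎odd n
    ... | k , inj₁ refl =
      hit-inBlock j₀ windowFirst (trans firstTarget (cong just (sym (pairsWith-even _ k)))) hitsAtFirst count
      where
      open Block k
      open FromStart (blockStart k)
      count : hitsBefore r var (k * 10) + 0 ≡ 2 * k
      count = trans (+-identityʳ _) (trans (hitsAtBlockStart k) (*-comm k 2))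
    ... | k , inj₂ refl =
      hit-inBlock j₁ windowSecond (trans secondTarget (cong just (sym (pairsWith-odd _ k)))) hitsAtSecond count
      where
      open Block k
      open FromStart (blockStart k)
      count : hitsBefore r var (k * 10) + 1 ≡ 1 + 2 * k
      count = trans (cong (_+ 1) (hitsAtBlockStart k)) (trans (+-comm (k * 2) 1) (cong suc (*-comm k 2)))

  blockHead-period : ∀ {var r M} → IsPeriod r (2 * M) → IsPeriod (blockHead var r) M
  blockHead-period {var} {r} {M} per k =
    trans (cong₂ (λ x₀ x₂ → firstLabel var x₀ x₂ (r ((k + M) * 2)))
                 (at per₂ (source₀ k M)) (at per₂ (source₂ k M)))
          (cong (firstLabel var (r (k * 4)) (r (2 + k * 4))) (at per (relay k M)))
    where
    per₂ : IsPeriod r (2 * (2 * M))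
    per₂ = isPeriod-* per 2
    at : ∀ {P i n} → IsPeriod r P → n ≡ i + P → r n ≡ r i
    at per′ refl = per′ _
    source₀ : ∀ k M → (k + M) * 4 ≡ k * 4 + 2 * (2 * M)
    source₀ = solve-∀
    source₂ : ∀ k M → 2 + (k + M) * 4 ≡ 2 + k * 4 + 2 * (2 * M)
    source₂ = solve-∀
    relay : ∀ k M → (k + M) * 2 ≡ k * 2 + 2 * M
    relay = solve-∀

  hitSeq-period : ∀ {var r p} → Even p → IsPeriod r p → IsPeriod (hitSeq var r) p
  hitSeq-period (M , refl) per = pairsWith-period (blockHead-period {M = M} per)

  hitSeq-baCount : ∀ {r} → PairFlipped r → ∀ K → baCount (hitSeq U r) K + baCount (hitSeq D r) K ≡ baCount r (2 * K)
  hitSeq-baCount flipped zero = refl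
  hitSeq-baCount {r} flipped (suc K) = begin
    baCount (hitSeq U r) (suc K) + baCount (hitSeq D r) (suc K)
      ≡⟨ cong₂ _+_ (baCount-pairsWith-suc (blockHead U r) K) (baCount-pairsWith-suc (blockHead D r) K) ⟩
    (baCount (hitSeq U r) K + baWeight (blockHead U r K)) + (baCount (hitSeq D r) K + baWeight (blockHead D r K))
      ≡⟨ interchange (baCount (hitSeq U r) K) _ _ _ ⟩
    (baCount (hitSeq U r) K + baCount (hitSeq D r) K) + (baWeight (blockHead U r K) + baWeight (blockHead D r K))
      ≡⟨ cong₂ _+_ (hitSeq-baCount flipped K) (firstLabel-U+D baWeight (r (K * 4)) (r (2 + K * 4)) (r (K * 2))) ⟩
    baCount r (2 * K) + (baWeight (r (K * 4)) + baWeight (r (2 + K * 4)))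
      ≡⟨ +-assoc (baCount r (2 * K)) _ _ ⟨
    baCount r (2 * K) + baWeight (r (K * 4)) + baWeight (r (2 + K * 4))
      ≡⟨ cong₂ (λ i j → baCount r (2 * K) + baWeight (r i) + baWeight (r j)) (fourfold K) (fourfold+2 K) ⟩
    baCount r (2 * K) + baWeight (r (2 * (2 * K))) + baWeight (r (2 * (1 + 2 * K)))
      ≡⟨ trans (baCount-pairFlipped-suc {r} flipped (1 + 2 * K))
               (cong (λ c → c + baWeight (r (2 * (1 + 2 * K)))) (baCount-pairFlipped-suc {r} flipped (2 * K))) ⟨
    baCount r (2 + 2 * K)
      ≡⟨ cong (baCount r) (*-suc 2 K) ⟨
    baCount r (2 * suc K) ∎
    where open ≡-Reasoning

  hitSeq-baFreq : ∀ {r p} → PairFlipped r → Even p → IsPeriod r p →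
                  baFreq (hitSeq U r) p ℚ.+ baFreq (hitSeq D r) p ≡ (+ 2 ℚ./ 1) ℚ.* baFreq r p
  hitSeq-baFreq flipped (zero , refl) per = refl
  hitSeq-baFreq {r} flipped (suc m , refl) per =
    baFreq-sum m (trans (hitSeq-baCount {r} flipped (suc m)) (baCount-* {a = suc m} per 2))

open import Data.Nat using (ℕ)
open import Data.Integer using (+_)
open import Data.Rational using (ℚ; _+_; _*_; _/_)
open import Data.Product using (_×_; ∃; _,_)
open import Relation.Binary.PropositionalEquality using (_≡_; trans; cong₂)

theorem8p2 : (r : Seq) (p : ℕ) → IsFundPeriod r p → r 0 ≡ ₁ → IsAbBa r p →
    ∃ λ (h₁ : Seq) → ∃ λ (h₂ : Seq) → ∃ λ (q₁ : ℕ) → ∃ λ (q₂ : ℕ) →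
      IsHitSeq r U h₁ × IsHitSeq r D h₂ ×
      IsFundPeriod h₁ q₁ × IsFundPeriod h₂ q₂ × Even q₁ × Even q₂ ×
      (baFreq h₁ q₁ + baFreq h₂ q₂ ≡ (+ 2 / 1) * baFreq r p)
theorem8p2 r p (0<p , per , _) _ abba@(even , _)
  with fundamentalPeriod-pairFlipped (pairsWith-pairFlipped (blockHead U r)) 0<p even (hitSeq-period {U} even per)
     | fundamentalPeriod-pairFlipped (pairsWith-pairFlipped (blockHead D r)) 0<p even (hitSeq-period {D} even per)
... | q₁ , fund₁ , even₁ , freq₁ | q₂ , fund₂ , even₂ , freq₂ =
  hitSeq U r , hitSeq D r , q₁ , q₂ , Blocks.hitSeq-isHitSeq flipped U , Blocks.hitSeq-isHitSeq flipped D ,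
  fund₁ , fund₂ , even₁ , even₂ , trans (cong₂ _+_ freq₁ freq₂) (hitSeq-baFreq flipped even per)
  where
  flipped : PairFlipped r
  flipped = abBa⇒pairFlipped {r} abba
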